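{- For each integer $n\ge13$ with $n\ne16$, \begin{align*} \mu_5^{\mathrm V}(G_n)-\mu_5^{\mathrm V}(H_n)&=\ell_3\ell_6\ell_9\ell_{10}+\ell_4\ell_7\ell_9\ell_{10}-\ell_2\ell_3\ell_7\ell_{12}-\ell_3\ell_6\ell_9\ell_{12}\\ &\quad+(\ell_1+1-\ell_5)(\ell_2\ell_7\ell_{12}+\ell_4\ell_7\ell_{10}+\ell_3\ell_6\ell_9+\ell_2\ell_6\ell_{11}+\ell_4\ell_8\ell_{11})\\ &\quad-(\ell_1+1-\ell_5)(\ell_8\ell_9\ell_{10}+\ell_3\ell_8\ell_{12}+\ell_4\ell_8\ell_{11})\\ &\quad+\ell_3\ell_{12}\Big(\sum_{\{i,j\}\in\binom{[12]\setminus\{1,3,5,12\}}{2}}\ell_i\ell_j+(\ell_1+1-\ell_5)\sum_{i\in[12]\setminus\{1,3,5,12\}}\ell_i\Big)\\ &\quad+\ell_9\ell_{10}\Big((\ell_1+1-\ell_5)\sum_{i\in[12]\setminus\{1,5,9,10\}}\ell_i-\sum_{\{i,j\}\in\binom{[12]\setminus\{1,5,9,10\}}{2}}\ell_i\ell_j\Big)\\ &\quad+\ell_8(\ell_1+1-\ell_5)\sum_{\{i,j\}\in\binom{[12]\setminus\{1,5,8\}}{2}}\ell_i\ell_j. \end{align*}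
   Context: $W$ (Wagner graph) has vertices $1,\dots,8$ and edges $e_1=15$, $e_2=37$, $e_3=26$, $e_4=48$, $e_5=12$, $e_6=67$, $e_7=34$, $e_8=81$, $e_9=56$, $e_{10}=45$, $e_{11}=78$, $e_{12}=23$. For positive integers $x_1,\dots,x_{12}$, $W(x_1,\dots,x_{12})$ is obtained from $W$ by replacing each $e_i$ with a path of $x_i$ edges (new internal vertices of degree 2); its chains (maximal paths whose internal vertices have degree 2 and whose ends have degree 3) are these paths, and its distillation is $W$, edge $e_i$ corresponding to the $i$-th chain. For $n\ge13$, $n\ne16$, let $r,s$ be the unique integers with $n+4=12s+r$, $r\in\{0,\dots,11\}$; $X_0=\emptyset$, $X_8=\{e_1,e_2,e_3,e_4,e_6,e_8,e_{10},e_{12}\}$, $X_r=\{e_1,\dots,e_r\}$ otherwise; $\ell_i=s+1$ if $e_i\in X_r$, else $\ell_i=s$; $G_n=W(\ell_1,\dots,\ell_{12})$ and $H_n=W(\ell_1',\dots,\ell_{12}')$ with $\ell_1'=\ell_1+1$, $\ell_5'=\ell_5-1$, $\ell_i'=\ell_i$ otherwise. A $k$-edge-cut is a set of $k$ edges whose removal disconnects the graph. An edge-cut $F$ of $W$ is vertex-separating if it contains all three edges incident to some vertex. For $G\in\{G_n,H_n\}$, a $5$-edge-cut $\{a_1,\dots,a_5\}$ of $G$ is induced by a $5$-edge-cut $\{f_1,\dots,f_5\}$ of $W$ if each $a_j$ lies in the chain of $G$ corresponding to $f_j$; $\mu_5^{\mathrm V}(G)$ is the number of $5$-edge-cuts of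 $G$ induced by vertex-separating $5$-edge-cuts of $W$. $[12]=\{1,\dots,12\}$, $\binom{S}{k}$ the $k$-subsets of $S$. -}

module Defs where

open import Data.Nat using (ℕ; zero; suc; _∸_; _<_; _≤_; _<?_; _≟_)
open import Data.Nat.DivMod using (_/_; _%_)
open import Data.Integer as Int using (ℤ; +_)
open import Data.Fin as Fin using (Fin; #_; toℕ; fromℕ<)
open import Data.Fin.Subset using (Subset; _∈_; _∉_; ∣_∣)
open import Data.List as List using (List; []; _∷_; length; map; concatMap; upTo; allFin; filter)
open import Data.List.Membership.DecPropositional _≟_ using (_∈?_)
open import Data.List.Relation.Unary.Unique.Propositional using (Unique)
import Data.List.Membership.Propositional as LMem
open import Data.Vec as Vec using (Vec; []; _∷_)
open import Data.Product using (Σ; ∃; ∃-syntax; _×_; _,_; proj₁; proj₂)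
open import Data.Sum using (_⊎_; inj₁; inj₂)
open import Data.Bool using (Bool; true; false; if_then_else_)
open import Relation.Nullary using (¬_; yes; no; ¬?)
open import Relation.Nullary.Decidable using (⌊_⌋)
open import Relation.Binary.PropositionalEquality using (_≡_)
open import Relation.Binary.Construct.Closure.ReflexiveTransitive using (Star)
open import Function.Bundles using (_⇔_)

record Graph : Set₁ where
  field
    V    : Set
    m    : ℕ
    ends : Fin m → V × V

open Graph public

Adj : (G : Graph) → Subset (m G) → V G → V G → Set
Adj G A u w = ∃[ e ] (e ∉ A × (ends G e ≡ (u , w) ⊎ ends G e ≡ (w , u)))

ConnectedWithout : (G : Graph) → Subset (m G) → Set
ConnectedWithout G A = ∀ u v → Star (Adj G A) u v

IsEdgeCut : (G : Graph) → ℕ → Subset (m G) → Set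
IsEdgeCut G k A = (∣ A ∣ ≡ k) × ¬ ConnectedWithout G A

-- The Wagner graph.  Vertex v ∈ {1..8} is Fin index v-1,
-- edge e_i (i ∈ {1..12}) is Fin index i-1.

wEnds : Vec (Fin 8 × Fin 8) 12
wEnds = (# 0 , # 4) ∷ (# 2 , # 6) ∷ (# 1 , # 5) ∷ (# 3 , # 7)
      ∷ (# 0 , # 1) ∷ (# 5 , # 6) ∷ (# 2 , # 3) ∷ (# 7 , # 0)
      ∷ (# 4 , # 5) ∷ (# 3 , # 4) ∷ (# 6 , # 7) ∷ (# 1 , # 2) ∷ []

W : Graph
W = record { V = Fin 8 ; m = 12 ; ends = Vec.lookup wEnds }

VertexSeparating : Subset 12 → Set
VertexSeparating F =
  ∃[ v ] (∀ (e : Fin 12) → (proj₁ (ends W e) ≡ v ⊎ proj₂ (ends W e) ≡ v) → e ∈ F)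

-- The subdivision W(x_1,...,x_12): chain i (edge e_{i+1}) becomes a path
-- of x i edges.  Vertices: the 8 branch vertices, plus the internal
-- vertices (i , j) standing for the (j+1)-th internal vertex of chain i.

SubV : (Fin 12 → ℕ) → Set
SubV x = Fin 8 ⊎ Σ (Fin 12) (λ i → Fin (x i ∸ 1))

pos : (x : Fin 12 → ℕ) → Fin 12 → ℕ → SubV x
pos x i zero = inj₁ (proj₁ (ends W i))
pos x i (suc j) with j <? (x i ∸ 1)
... | yes p = inj₂ (i , fromℕ< p)
... | no  _ = inj₁ (proj₂ (ends W i))

subEdges : (x : Fin 12 → ℕ) → List (Fin 12 × (SubV x × SubV x))
subEdges x = concatMap (λ i → map (λ k → (i , (pos x i k , pos x i (suc k)))) (upTo (x i)))
                       (allFin 12)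

Sub : (Fin 12 → ℕ) → Graph
Sub x = record { V = SubV x ; m = length (subEdges x)
               ; ends = λ e → proj₂ (List.lookup (subEdges x) e) }

chain : (x : Fin 12 → ℕ) → Fin (m (Sub x)) → Fin 12
chain x e = proj₁ (List.lookup (subEdges x) e)

InducedByVS5 : (x : Fin 12 → ℕ) → Subset (m (Sub x)) → Set
InducedByVS5 x A =
  Σ (Subset 12) λ F → IsEdgeCut W 5 F × VertexSeparating F ×
    Σ (Fin 5 → Fin (m (Sub x))) λ a → Σ (Fin 5 → Fin 12) λ f →
      (∀ e → e ∈ A ⇔ (∃[ j ] (a j ≡ e))) ×
      (∀ e → e ∈ F ⇔ (∃[ j ] (f j ≡ e))) ×
      (∀ j → chain x (a j) ≡ f j)

-- μ₅^V(W(x)) = c : c is the number of such 5-edge-cuts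
-- (a duplicate-free list enumerating exactly them, of length c)
Mu5V≡ : (x : Fin 12 → ℕ) → ℕ → Set
Mu5V≡ x c = Σ (List (Subset (m (Sub x)))) λ L →
  Unique L × (∀ A → (A LMem.∈ L) ⇔ (IsEdgeCut (Sub x) 5 A × InducedByVS5 x A)) × length L ≡ c

sOf rOf : ℕ → ℕ
sOf n = (n Data.Nat.+ 4) / 12
rOf n = (n Data.Nat.+ 4) % 12

inX : ℕ → ℕ → Bool
inX r i = if ⌊ r ≟ 8 ⌋ then ⌊ i ∈? (1 ∷ 2 ∷ 3 ∷ 4 ∷ 6 ∷ 8 ∷ 10 ∷ 12 ∷ []) ⌋
          else ⌊ 1 Data.Nat.≤? i ⌋ Data.Bool.∧ ⌊ i Data.Nat.≤? r ⌋
  where open import Data.Nat using (_≤?_)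
        open import Data.Bool using (_∧_)

ℓ : ℕ → ℕ → ℕ
ℓ n i = if inX (rOf n) i then suc (sOf n) else sOf n

ℓ′ : ℕ → ℕ → ℕ
ℓ′ n i = if ⌊ i ≟ 1 ⌋ then suc (ℓ n i) else if ⌊ i ≟ 5 ⌋ then ℓ n i ∸ 1 else ℓ n i

-- chain lengths as functions of the Fin 12 index (index i-1 ↦ e_i)
Gn Hn : ℕ → Fin 12 → ℕ
Gn n i = ℓ n (suc (toℕ i))
Hn n i = ℓ′ n (suc (toℕ i))

minus : List ℕ → List ℕ
minus S = filter (λ i → ¬? (i ∈? S)) (List.applyUpTo suc 12)

Σ₁ : List ℕ → (ℕ → ℤ) → ℤ
Σ₁ []       f = + 0
Σ₁ (i ∷ is) f = f i Int.+ Σ₁ is f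

-- sum over 2-element subsets {i,j} of the (duplicate-free) list
Σ₂ : List ℕ → (ℕ → ℤ) → ℤ
Σ₂ []       f = + 0
Σ₂ (i ∷ is) f = Σ₁ is (λ j → f i Int.* f j) Int.+ Σ₂ is f

RHS : ℕ → ℤ
RHS n =
    L 3 * L 6 * L 9 * L 10 + L 4 * L 7 * L 9 * L 10 - L 2 * L 3 * L 7 * L 12 - L 3 * L 6 * L 9 * L 12
  + d * (L 2 * L 7 * L 12 + L 4 * L 7 * L 10 + L 3 * L 6 * L 9 + L 2 * L 6 * L 11 + L 4 * L 8 * L 11)
  - d * (L 8 * L 9 * L 10 + L 3 * L 8 * L 12 + L 4 * L 8 * L 11)
  + L 3 * L 12 * (Σ₂ (minus (1 ∷ 3 ∷ 5 ∷ 12 ∷ [])) L + d * Σ₁ (minus (1 ∷ 3 ∷ 5 ∷ 12 ∷ [])) L)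
  + L 9 * L 10 * (d * Σ₁ (minus (1 ∷ 5 ∷ 9 ∷ 10 ∷ [])) L - Σ₂ (minus (1 ∷ 5 ∷ 9 ∷ 10 ∷ [])) L)
  + L 8 * d * Σ₂ (minus (1 ∷ 5 ∷ 8 ∷ [])) L
  where
    open Int using (_+_; _*_; _-_)
    L : ℕ → ℤ
    L i = + ℓ n i
    d : ℤ
    d = L 1 + + 1 - L 5

{-# OPTIONS --safe #-}
-- A 5-edge-cut of W(x) induced by a vertex-separating 5-edge-cut F of W has exactly one edge on
-- each chain of F, because the five chains of F are distinct.  Conversely any such choice of one
-- edge per chain of F is a cut: if F contains the three edges at v, the chosen edges separate v
-- from the other branch vertices, and F is recovered from the cut as its set of chains.  Hence
-- μ₅ⱽ(W(x)) = Σ_F ∏_{i ∈ F} x_i over the vertex-separating 5-subsets F of E(W).  H_n differs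
-- from G_n only by ℓ₁ ↦ ℓ₁ + 1 and ℓ₅ ↦ ℓ₅ - 1, so the claim is a polynomial identity in the
-- ℓ_i, which ring normalisation confirms.
module Submission where

open import Defs
open import Data.Nat as ℕ using (ℕ; zero; suc; _+_; _*_; _∸_; _≤_; _≰_; _<_; _≤?_; _<?_; z≤n; s≤s)
import Data.Nat.Properties as ℕ
open import Data.Nat.DivMod using (_mod_; m≥n⇒m/n>0)
open import Data.Nat.ListAction using (sum)
open import Data.Integer as ℤ using (ℤ; +_; _-_)
import Data.Integer.Properties as ℤ
open import Data.Integer.Solver using (module +-*-Solver)
open +-*-Solver using (Polynomial; var; con; _:+_; _:*_; _:-_; ⟦_⟧; prove)
open import Data.Fin as Fin using (Fin; zero; suc; toℕ; cast; punchIn; punchOut)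
import Data.Fin.Properties as Fin
open import Data.Fin.Subset using (Subset; inside; outside; _∈_; _∉_; ∣_∣)
open import Data.Fin.Subset.Properties using (_∈?_; drop-there; ⊆-antisym)
open import Data.Vec using (Vec; []; _∷_; here; there; lookup; tabulate)
open import Data.Vec.Properties
  using (∷-injective; ∷-injectiveʳ; lookup∘tabulate; tabulate∘lookup; tabulate-cong; []=⇒lookup; lookup⇒[]=)
open import Data.Bool using (Bool; true; false)
open import Data.Maybe using (Maybe; just; nothing)
open import Data.Maybe.Properties as Maybe using (just-injective)
open import Data.List as List using (List; []; _∷_; _++_; map; concatMap; filter; length; upTo; allFin)
open import Data.List.Properties
  using (length-map; length-++; length-upTo; map-cong; map-concatMap; concatMap-cong; map-∘)
open import Data.List.Membership.Propositional using (find; lose) renaming (_∈_ to _∈ₗ_)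
open import Data.List.Membership.Propositional.Properties
  using (∈-map⁺; ∈-map⁻; ∈-++⁺ˡ; ∈-++⁺ʳ; ∈-++⁻; ∈-filter⁺; ∈-filter⁻; ∈-concatMap⁺; ∈-concatMap⁻;
         ∈-upTo⁺; ∈-upTo⁻; ∈-allFin; ∈-lookup)
open import Data.List.Relation.Unary.All as All using ([])
open import Data.List.Relation.Unary.All.Properties as All using ()
open import Data.List.Relation.Unary.Any using (here; there; index)
open import Data.List.Relation.Unary.Any.Properties using (lookup-index)
open import Data.List.Relation.Unary.AllPairs as AllPairs using ([]; _∷_)
import Data.List.Relation.Unary.AllPairs.Properties as AllPairs
open import Data.List.Relation.Unary.Unique.Propositional using (Unique)
import Data.List.Relation.Unary.Unique.Propositional.Properties as Unique
open import Data.Product as Product using (Σ; ∃-syntax; _×_; _,_; proj₁; proj₂)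
open import Data.Product.Properties using (,-injectiveˡ; ,-injectiveʳ)
open import Data.Sum using (_⊎_; inj₁; inj₂)
open import Data.Unit using (tt)
open import Function using (_∘_; _⇔_; mk⇔; Equivalence)
open import Function.Definitions using (Injective)
open import Relation.Nullary using (¬_; Dec; yes; no; ¬?; contradiction)
open import Relation.Nullary.Decidable using (does; dec-true; dec-false; does-⇔; toWitness; _⊎-dec_; _→-dec_)
open import Relation.Unary using (Decidable)
open import Relation.Binary.PropositionalEquality
open import Relation.Binary.Construct.Closure.ReflexiveTransitive using (Star; ε; _◅_)

private variable
  A B : Set
  k n : ℕ
  xs : List A

-- Finite sets and lists

enumerate : (p : Subset n) → Fin ∣ p ∣ → Fin n
enumerate (outside ∷ p) j       = suc (enumerate p j)
enumerate (inside  ∷ p) zero    = zero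
enumerate (inside  ∷ p) (suc j) = suc (enumerate p j)

enumerate-∈ : (p : Subset n) (j : Fin ∣ p ∣) → enumerate p j ∈ p
enumerate-∈ (outside ∷ p) j       = there (enumerate-∈ p j)
enumerate-∈ (inside  ∷ p) zero    = here
enumerate-∈ (inside  ∷ p) (suc j) = there (enumerate-∈ p j)

enumerate-injective : (p : Subset n) → Injective _≡_ _≡_ (enumerate p)
enumerate-injective (outside ∷ p)                 eq = enumerate-injective p (Fin.suc-injective eq)
enumerate-injective (inside  ∷ p) {zero}  {zero}  _  = refl
enumerate-injective (inside  ∷ p) {suc i} {suc j} eq = cong suc (enumerate-injective p (Fin.suc-injective eq))

enumerate-surjective : (p : Subset n) {y : Fin n} → y ∈ p → ∃[ j ] enumerate p j ≡ y
enumerate-surjective (outside ∷ p) (there y∈p) = Product.map₂ (cong suc) (enumerate-surjective p y∈p)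
enumerate-surjective (inside  ∷ p) here        = zero , refl
enumerate-surjective (inside  ∷ p) (there y∈p) = Product.map suc (cong suc) (enumerate-surjective p y∈p)

module _ {p : Subset n} (g : Fin k → Fin n) where

  Covers : Set
  Covers = ∀ {y} → y ∈ p → ∃[ j ] g j ≡ y

  ∣p∣≤-covering : Covers → ∣ p ∣ ≤ k
  ∣p∣≤-covering cover = Fin.injective⇒≤ preimage-injective
    where
    preimage : Fin ∣ p ∣ → Fin k
    preimage i = proj₁ (cover (enumerate-∈ p i))
    preimage-injective : Injective _≡_ _≡_ preimage
    preimage-injective {i} {i′} eq = enumerate-injective p (begin
      enumerate p i   ≡⟨ proj₂ (cover (enumerate-∈ p i)) ⟨
      g (preimage i)  ≡⟨ cong g eq ⟩
      g (preimage i′) ≡⟨ proj₂ (cover (enumerate-∈ p i′)) ⟩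
      enumerate p i′  ∎)
      where open ≡-Reasoning

  ≤∣p∣-injective : Injective _≡_ _≡_ g → (∀ j → g j ∈ p) → k ≤ ∣ p ∣
  ≤∣p∣-injective g-injective g∈p = Fin.injective⇒≤ index-injective
    where
    index-of : Fin k → Fin ∣ p ∣
    index-of j = proj₁ (enumerate-surjective p (g∈p j))
    index-injective : Injective _≡_ _≡_ index-of
    index-injective {j} {j′} eq = g-injective (begin
      g j                       ≡⟨ proj₂ (enumerate-surjective p (g∈p j)) ⟨
      enumerate p (index-of j)  ≡⟨ cong (enumerate p) eq ⟩
      enumerate p (index-of j′) ≡⟨ proj₂ (enumerate-surjective p (g∈p j′)) ⟩
      g j′                      ∎)
      where open ≡-Reasoning

  ∣image∣≡ : Injective _≡_ _≡_ g → (∀ j → g j ∈ p) → Covers → ∣ p ∣ ≡ k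
  ∣image∣≡ g-injective g∈p cover = ℕ.≤-antisym (∣p∣≤-covering cover) (≤∣p∣-injective g-injective g∈p)

-- If g j ≡ g j′ with j ≢ j′, then g ∘ punchIn j′ still covers p with one point less.
covering-injective : {p : Subset n} (g : Fin k → Fin n) → ∣ p ∣ ≡ k → Covers {p = p} g →
                     Injective _≡_ _≡_ g
covering-injective {k = suc k} {p = p} g ∣p∣≡k cover {j} {j′} gj≡gj′ with j Fin.≟ j′
... | yes j≡j′ = j≡j′
... | no  j≢j′ =
  contradiction (∣p∣≤-covering (g ∘ punchIn j′) cover′) (subst (_≰ k) (sym ∣p∣≡k) (ℕ.n≮n k))
  where
  cover′ : Covers {p = p} (g ∘ punchIn j′)
  cover′ y∈p with cover y∈p
  ... | t , refl with t Fin.≟ j′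
  ...   | yes refl = punchOut (j≢j′ ∘ sym) , trans (cong g (Fin.punchIn-punchOut (j≢j′ ∘ sym))) gj≡gj′
  ...   | no  t≢j′ = punchOut (t≢j′ ∘ sym) , cong g (Fin.punchIn-punchOut (t≢j′ ∘ sym))

enumeration : (p : Subset n) → ∣ p ∣ ≡ k →
              Σ (Fin k → Fin n) λ f → Injective _≡_ _≡_ f × (∀ j → f j ∈ p) × Covers {p = p} f
enumeration p refl = enumerate p , enumerate-injective p , enumerate-∈ p , enumerate-surjective p

∈-tabulate⇔ : {P : Fin n → Set} (P? : Decidable P) {i : Fin n} → i ∈ tabulate (does ∘ P?) ⇔ P i
∈-tabulate⇔ {P = P} P? {i} =
  mk⇔ to (λ Pi → lookup⇒[]= i _ (trans (lookup∘tabulate _ i) (dec-true (P? i) Pi)))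
  where
  to : i ∈ tabulate (does ∘ P?) → P i
  to i∈ with P? i | trans (sym (lookup∘tabulate (does ∘ P?) i)) ([]=⇒lookup i∈)
  ... | yes Pi | _ = Pi

just-agreement : {u v : Maybe A} → (∀ {a} → u ≡ just a → v ≡ just a) → (∀ {a} → v ≡ just a → u ≡ just a) →
                 u ≡ v
just-agreement {u = just a}                to _    = sym (to refl)
just-agreement {u = nothing} {v = nothing} _  _    = refl
just-agreement {u = nothing} {v = just a}  _  from with () ← from refl

module _ {G : A → List B} where

  ∈-concatMap⁺′ : ∀ {x y} → x ∈ₗ xs → y ∈ₗ G x → y ∈ₗ concatMap G xs
  ∈-concatMap⁺′ x∈xs y∈Gx = ∈-concatMap⁺ G (lose x∈xs y∈Gx)

  ∈-concatMap⁻′ : ∀ {y} → y ∈ₗ concatMap G xs → ∃[ x ] x ∈ₗ xs × y ∈ₗ G x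
  ∈-concatMap⁻′ = find ∘ ∈-concatMap⁻ G

  unique-concatMap : Unique xs → (∀ x → Unique (G x)) →
                     (∀ {x x′ y} → y ∈ₗ G x → y ∈ₗ G x′ → x ≡ x′) → Unique (concatMap G xs)
  unique-concatMap xs! G! fibres-disjoint =
    Unique.concat⁺ (All.map⁺ (All.universal G! _))
      (AllPairs.map⁺ (AllPairs.map (λ x≢x′ {_} (y∈ , y∈′) → x≢x′ (fibres-disjoint y∈ y∈′)) xs!))

  length-concatMap : (xs : List A) → length (concatMap G xs) ≡ sum (map (length ∘ G) xs)
  length-concatMap []       = refl
  length-concatMap (x ∷ xs) = trans (length-++ (G x)) (cong (length (G x) ℕ.+_) (length-concatMap xs))

  length-concatMap-const : ∀ {c} → (∀ x → length (G x) ≡ c) → (xs : List A) →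
                           length (concatMap G xs) ≡ length xs * c
  length-concatMap-const ∣G∣≡c []       = refl
  length-concatMap-const ∣G∣≡c (x ∷ xs) =
    trans (length-++ (G x)) (cong₂ _+_ (∣G∣≡c x) (length-concatMap-const ∣G∣≡c xs))

unique-map-on : {f : A → B} → Unique xs → (∀ {x y} → x ∈ₗ xs → y ∈ₗ xs → f x ≡ f y → x ≡ y) →
                Unique (map f xs)
unique-map-on {xs = []}     []           _     = []
unique-map-on {xs = x ∷ xs} (x∉xs ∷ xs!) f-inj =
  All.map⁺ (All.tabulate λ y∈xs fx≡fy → All.lookup x∉xs y∈xs (f-inj (here refl) (there y∈xs) fx≡fy))
  ∷ unique-map-on xs! λ x∈ y∈ → f-inj (there x∈) (there y∈)

unique⇒lookup-injective : Unique xs → Injective _≡_ _≡_ (List.lookup xs)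
unique⇒lookup-injective {xs = x ∷ xs} _          {zero}  {zero}  _  = refl
unique⇒lookup-injective {xs = x ∷ xs} (x∉xs ∷ _) {zero}  {suc j} eq =
  contradiction eq (All.lookup x∉xs (∈-lookup j))
unique⇒lookup-injective {xs = x ∷ xs} (x∉xs ∷ _) {suc i} {zero}  eq =
  contradiction (sym eq) (All.lookup x∉xs (∈-lookup i))
unique⇒lookup-injective {xs = x ∷ xs} (_ ∷ xs!)  {suc i} {suc j} eq = cong suc (unique⇒lookup-injective xs! eq)

lookup-map : (h : A → B) (xs : List A) (i : Fin (length (map h xs))) →
             List.lookup (map h xs) i ≡ h (List.lookup xs (cast (length-map h xs) i))
lookup-map h (x ∷ xs) zero    = refl
lookup-map h (x ∷ xs) (suc i) = lookup-map h xs i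

-- Choosing one edge on each chain

private variable
  F F′ : Subset n
  x : Fin n → ℕ
  c : Vec (Maybe ℕ) n
  i : Fin n

-- An entry just k at i marks the (k+1)-th of the x i edges of chain i.
data IsChoice : Subset n → (Fin n → ℕ) → Vec (Maybe ℕ) n → Set where
  []    : IsChoice [] x []
  _∷ᵢ_  : k < x zero → IsChoice F (x ∘ suc) c → IsChoice (inside ∷ F) x (just k ∷ c)
  ∷ₒ_   : IsChoice F (x ∘ suc) c → IsChoice (outside ∷ F) x (nothing ∷ c)

choices : Subset n → (Fin n → ℕ) → List (Vec (Maybe ℕ) n)
choices []            x = [] ∷ []
choices (outside ∷ F) x = map (nothing ∷_) (choices F (x ∘ suc))
choices (inside  ∷ F) x = concatMap (λ k → map (just k ∷_) (choices F (x ∘ suc))) (upTo (x zero))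

∏ : Subset n → (Fin n → ℕ) → ℕ
∏ []            x = 1
∏ (outside ∷ F) x = ∏ F (x ∘ suc)
∏ (inside  ∷ F) x = x zero * ∏ F (x ∘ suc)

∈-choices⁺ : IsChoice F x c → c ∈ₗ choices F x
∈-choices⁺ []           = here refl
∈-choices⁺ (k< ∷ᵢ isC)  = ∈-concatMap⁺′ (∈-upTo⁺ k<) (∈-map⁺ _ (∈-choices⁺ isC))
∈-choices⁺ (∷ₒ isC)     = ∈-map⁺ _ (∈-choices⁺ isC)

∈-choices⁻ : (F : Subset n) → c ∈ₗ choices F x → IsChoice F x c
∈-choices⁻ {c = []}    []            _     = []
∈-choices⁻             (outside ∷ F) c∈ with _ , c′∈ , refl ← ∈-map⁻ _ c∈ = ∷ₒ ∈-choices⁻ F c′∈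
∈-choices⁻ {x = x}     (inside  ∷ F) c∈
  with k , k∈ , c∈′ ← ∈-concatMap⁻′ {xs = upTo (x zero)} c∈
  with _ , c′∈ , refl ← ∈-map⁻ _ c∈′ = ∈-upTo⁻ k∈ ∷ᵢ ∈-choices⁻ F c′∈

choices-unique : (F : Subset n) (x : Fin n → ℕ) → Unique (choices F x)
choices-unique []            x = [] ∷ []
choices-unique (outside ∷ F) x = Unique.map⁺ ∷-injectiveʳ (choices-unique F (x ∘ suc))
choices-unique (inside  ∷ F) x =
  unique-concatMap (Unique.upTo⁺ (x zero)) (λ _ → Unique.map⁺ ∷-injectiveʳ (choices-unique F (x ∘ suc)))
    λ c∈ c∈′ → heads-agree (proj₂ (proj₂ (∈-map⁻ _ c∈))) (proj₂ (proj₂ (∈-map⁻ _ c∈′)))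
  where
  heads-agree : ∀ {k k′} {c : Vec (Maybe ℕ) (suc _)} {d d′} →
                c ≡ just k ∷ d → c ≡ just k′ ∷ d′ → k ≡ k′
  heads-agree refl eq = just-injective (proj₁ (∷-injective eq))

length-choices : (F : Subset n) (x : Fin n → ℕ) → length (choices F x) ≡ ∏ F x
length-choices []            x = refl
length-choices (outside ∷ F) x = trans (length-map _ (choices F _)) (length-choices F _)
length-choices (inside  ∷ F) x =
  trans (length-concatMap-const (λ _ → trans (length-map _ (choices F _)) (length-choices F _)) (upTo (x zero)))
        (cong (_* ∏ F (x ∘ suc)) (length-upTo (x zero)))

choice-support-unique : IsChoice F x c → IsChoice F′ x c → F ≡ F′
choice-support-unique []          []           = refl
choice-support-unique (_ ∷ᵢ isC)  (_ ∷ᵢ isC′)  = cong (inside ∷_) (choice-support-unique isC isC′)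
choice-support-unique (∷ₒ isC)    (∷ₒ isC′)    = cong (outside ∷_) (choice-support-unique isC isC′)

choice-∈ : IsChoice F x c → lookup c i ≡ just k → i ∈ F
choice-∈ {i = zero}  (_ ∷ᵢ _)   _  = here
choice-∈ {i = suc i} (_ ∷ᵢ isC) eq = there (choice-∈ isC eq)
choice-∈ {i = suc i} (∷ₒ isC)   eq = there (choice-∈ isC eq)

choice-< : IsChoice F x c → lookup c i ≡ just k → k < x i
choice-< {i = zero}  (k< ∷ᵢ _)  refl = k<
choice-< {i = suc i} (_ ∷ᵢ isC) eq   = choice-< isC eq
choice-< {i = suc i} (∷ₒ isC)   eq   = choice-< isC eq

choice-just : IsChoice F x c → i ∈ F → ∃[ k ] lookup c i ≡ just k
choice-just (_ ∷ᵢ _)   here         = _ , refl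
choice-just (_ ∷ᵢ isC) (there i∈F) = choice-just isC i∈F
choice-just (∷ₒ isC)   (there i∈F) = choice-just isC i∈F

pointwise⇒choice : (F : Subset n) (c : Vec (Maybe ℕ) n) →
                   (∀ {i} → i ∈ F → ∃[ k ] lookup c i ≡ just k × k < x i) →
                   (∀ {i} → i ∉ F → lookup c i ≡ nothing) → IsChoice F x c
pointwise⇒choice []            []      _      _        = []
pointwise⇒choice (inside ∷ F)  (_ ∷ c) chosen unchosen with chosen here
... | k , refl , k< = k< ∷ᵢ pointwise⇒choice F c (chosen ∘ there) (λ i∉F → unchosen (i∉F ∘ drop-there))
pointwise⇒choice (outside ∷ F) (_ ∷ c) chosen unchosen with unchosen {zero} (λ ())
... | refl = ∷ₒ pointwise⇒choice F c (chosen ∘ there) (λ i∉F → unchosen (i∉F ∘ drop-there))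

-- The vertex-separating 5-subsets of E(W)

-- Opaque, so that type checking never evaluates these concrete lists; only the polynomial
-- identity unfolds them.
opaque
  subsetsOfSize : (n k : ℕ) → List (Subset n)
  subsetsOfSize zero    zero    = [] ∷ []
  subsetsOfSize zero    (suc k) = []
  subsetsOfSize (suc n) zero    = map (outside ∷_) (subsetsOfSize n zero)
  subsetsOfSize (suc n) (suc k) =
    map (inside ∷_) (subsetsOfSize n k) ++ map (outside ∷_) (subsetsOfSize n (suc k))

  ∈-subsetsOfSize⁺ : (p : Subset n) → p ∈ₗ subsetsOfSize n ∣ p ∣
  ∈-subsetsOfSize⁺ []            = here refl
  ∈-subsetsOfSize⁺ (inside ∷ p)  = ∈-++⁺ˡ (∈-map⁺ (inside ∷_) (∈-subsetsOfSize⁺ p))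
  ∈-subsetsOfSize⁺ {suc n} (outside ∷ p) with ∣ p ∣ | ∈-subsetsOfSize⁺ p
  ... | zero  | p∈ = ∈-map⁺ (outside ∷_) p∈
  ... | suc k | p∈ = ∈-++⁺ʳ (map (inside ∷_) (subsetsOfSize n k)) (∈-map⁺ (outside ∷_) p∈)

  ∈-subsetsOfSize⁻ : ∀ n k {p} → p ∈ₗ subsetsOfSize n k → ∣ p ∣ ≡ k
  ∈-subsetsOfSize⁻ zero    zero    (here refl) = refl
  ∈-subsetsOfSize⁻ (suc n) zero    p∈ with _ , q∈ , refl ← ∈-map⁻ (outside ∷_) p∈ =
    ∈-subsetsOfSize⁻ n zero q∈
  ∈-subsetsOfSize⁻ (suc n) (suc k) p∈ with ∈-++⁻ (map (inside ∷_) (subsetsOfSize n k)) p∈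
  ... | inj₁ p∈ˡ with _ , q∈ , refl ← ∈-map⁻ (inside ∷_) p∈ˡ = cong suc (∈-subsetsOfSize⁻ n k q∈)
  ... | inj₂ p∈ʳ with _ , q∈ , refl ← ∈-map⁻ (outside ∷_) p∈ʳ = ∈-subsetsOfSize⁻ n (suc k) q∈

  subsetsOfSize-unique : ∀ n k → Unique (subsetsOfSize n k)
  subsetsOfSize-unique zero    zero    = [] ∷ []
  subsetsOfSize-unique zero    (suc k) = []
  subsetsOfSize-unique (suc n) zero    = Unique.map⁺ ∷-injectiveʳ (subsetsOfSize-unique n zero)
  subsetsOfSize-unique (suc n) (suc k) =
    Unique.++⁺ (Unique.map⁺ ∷-injectiveʳ (subsetsOfSize-unique n k))
               (Unique.map⁺ ∷-injectiveʳ (subsetsOfSize-unique n (suc k)))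
               λ (p∈ˡ , p∈ʳ) → heads-differ (proj₂ (proj₂ (∈-map⁻ (inside ∷_) p∈ˡ)))
                                            (proj₂ (proj₂ (∈-map⁻ (outside ∷_) p∈ʳ)))
    where
    heads-differ : ∀ {p : Subset (suc n)} {q r} → p ≡ inside ∷ q → p ≢ outside ∷ r
    heads-differ refl ()

vertexSeparating? : Decidable VertexSeparating
vertexSeparating? F = Fin.any? λ v → Fin.all? λ e →
  ((proj₁ (ends W e) Fin.≟ v) ⊎-dec (proj₂ (ends W e) Fin.≟ v)) →-dec (e ∈? F)

opaque
  vertexSeparating5 : List (Subset 12)
  vertexSeparating5 = filter vertexSeparating? (subsetsOfSize 12 5)

  ∈-vertexSeparating5⇔ : ∀ {F} → F ∈ₗ vertexSeparating5 ⇔ (∣ F ∣ ≡ 5 × VertexSeparating F)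
  ∈-vertexSeparating5⇔ {F} = mk⇔ to from
    where
    to : F ∈ₗ vertexSeparating5 → ∣ F ∣ ≡ 5 × VertexSeparating F
    to F∈ = Product.map₁ (∈-subsetsOfSize⁻ 12 5) (∈-filter⁻ vertexSeparating? {xs = subsetsOfSize 12 5} F∈)
    from : ∣ F ∣ ≡ 5 × VertexSeparating F → F ∈ₗ vertexSeparating5
    from (∣F∣≡5 , vs) = ∈-filter⁺ vertexSeparating? {xs = subsetsOfSize 12 5}
      (subst (λ k → F ∈ₗ subsetsOfSize 12 k) ∣F∣≡5 (∈-subsetsOfSize⁺ F)) vs

  vertexSeparating5-unique : Unique vertexSeparating5
  vertexSeparating5-unique =
    Unique.filter⁺ vertexSeparating? {xs = subsetsOfSize 12 5} (subsetsOfSize-unique 12 5)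

-- Chosen edges form a cut of W(x)

module Addresses (x : Fin 12 → ℕ) where

  Edge : Set
  Edge = Fin (m (Sub x))

  addresses : List (Fin 12 × ℕ)
  addresses = concatMap (λ i → map (i ,_) (upTo (x i))) (allFin 12)

  edgeAt : Fin 12 × ℕ → Fin 12 × (SubV x × SubV x)
  edgeAt (i , k) = i , pos x i k , pos x i (suc k)

  subEdges≡ : subEdges x ≡ map edgeAt addresses
  subEdges≡ = sym (trans (map-concatMap edgeAt (λ i → map (i ,_) (upTo (x i))) (allFin 12))
                         (concatMap-cong (λ i → sym (map-∘ {g = edgeAt} {f = i ,_} (upTo (x i)))) (allFin 12)))

  #edges≡ : m (Sub x) ≡ length addresses
  #edges≡ = trans (cong length subEdges≡) (length-map edgeAt addresses)

  -- Edge e is the (k+1)-th edge of chain i, where (i , k) = address e.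
  address : Edge → Fin 12 × ℕ
  address e = List.lookup addresses (cast #edges≡ e)

  lookup-subEdges : ∀ e → List.lookup (subEdges x) e ≡ edgeAt (address e)
  lookup-subEdges = along subEdges≡
    where
    along : ∀ {ys} (ys≡ : ys ≡ map edgeAt addresses) (e : Fin (length ys)) →
            List.lookup ys e ≡
              edgeAt (List.lookup addresses (cast (trans (cong length ys≡) (length-map edgeAt addresses)) e))
    along refl = lookup-map edgeAt addresses

  chain≡ : ∀ e → chain x e ≡ proj₁ (address e)
  chain≡ e = cong proj₁ (lookup-subEdges e)

  ends≡ : ∀ e → let (i , k) = address e in ends (Sub x) e ≡ (pos x i k , pos x i (suc k))
  ends≡ e = cong proj₂ (lookup-subEdges e)

  ∈-addresses⇒< : ∀ {i k} → (i , k) ∈ₗ addresses → k < x i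
  ∈-addresses⇒< ik∈
    with j , _ , ik∈′ ← ∈-concatMap⁻′ {G = λ i → map (i ,_) (upTo (x i))} {xs = allFin 12} ik∈
    with k , k∈ , refl ← ∈-map⁻ (j ,_) ik∈′ = ∈-upTo⁻ k∈

  address-< : ∀ e → let (i , k) = address e in k < x i
  address-< e = ∈-addresses⇒< (∈-lookup (cast #edges≡ e))

  addresses-unique : Unique addresses
  addresses-unique =
    unique-concatMap (Unique.allFin⁺ 12) (λ i → Unique.map⁺ ,-injectiveʳ (Unique.upTo⁺ (x i)))
      λ {i} {i′} ik∈ ik∈′ → chains-agree (proj₂ (proj₂ (∈-map⁻ (i ,_) ik∈)))
                                         (proj₂ (proj₂ (∈-map⁻ (i′ ,_) ik∈′)))
    where
    chains-agree : ∀ {a : Fin 12 × ℕ} {i i′ k k′} → a ≡ (i , k) → a ≡ (i′ , k′) → i ≡ i′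
    chains-agree refl eq = ,-injectiveˡ eq

  address-injective : Injective _≡_ _≡_ address
  address-injective {e} {e′} eq = begin
    e                        ≡⟨ Fin.cast-involutive (sym #edges≡) #edges≡ e ⟨
    cast _ (cast #edges≡ e)  ≡⟨ cong (cast (sym #edges≡)) (unique⇒lookup-injective addresses-unique eq) ⟩
    cast _ (cast #edges≡ e′) ≡⟨ Fin.cast-involutive (sym #edges≡) #edges≡ e′ ⟩
    e′                       ∎
    where open ≡-Reasoning

  address-surjective : ∀ {i k} → k < x i → ∃[ e ] address e ≡ (i , k)
  address-surjective {i} {k} k< = cast (sym #edges≡) t , (begin
    List.lookup addresses (cast #edges≡ (cast (sym #edges≡) t))
      ≡⟨ cong (List.lookup addresses) (Fin.cast-involutive #edges≡ (sym #edges≡) t) ⟩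
    List.lookup addresses t
      ≡⟨ lookup-index ik∈ ⟨
    (i , k) ∎)
    where
    open ≡-Reasoning
    ik∈ : (i , k) ∈ₗ addresses
    ik∈ = ∈-concatMap⁺′ {G = λ i → map (i ,_) (upTo (x i))} (∈-allFin i) (∈-map⁺ (i ,_) (∈-upTo⁺ k<))
    t : Fin (length addresses)
    t = index ik∈

colouring⇒disconnected : (G : Graph) {A : Subset (m G)} (f : V G → Bool) →
                         (∀ {u w} → Adj G A u w → f u ≡ f w) →
                         ∀ {u w} → f u ≡ true → f w ≡ false → ¬ ConnectedWithout G A
colouring⇒disconnected G f f-respects {u} {w} fu fw connected =
  contradiction (trans (sym fu) (trans (along (connected u w)) fw)) λ ()
  where
  along : ∀ {u w} → Star (Adj G _) u w → f u ≡ f w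
  along ε        = refl
  along (a ◅ as) = trans (f-respects a) (along as)

Incident : Fin 8 → Fin 12 → Set
Incident v e = proj₁ (ends W e) ≡ v ⊎ proj₂ (ends W e) ≡ v

vertexSeparating⇒disconnected : ∀ {F} → VertexSeparating F → ¬ ConnectedWithout W F
vertexSeparating⇒disconnected {F} (v , star⊆F) =
  colouring⇒disconnected W (λ u → does (u Fin.≟ v)) respects {u = v} {w = punchIn v zero}
    (dec-true (v Fin.≟ v) refl) (dec-false (punchIn v zero Fin.≟ v) (Fin.punchInᵢ≢i v zero))
  where
  off-v : ∀ {e u} → e ∉ F → Incident u e → does (u Fin.≟ v) ≡ false
  off-v {u = u} e∉F e~u = dec-false (u Fin.≟ v) λ { refl → e∉F (star⊆F _ e~u) }
  respects : ∀ {u w} → Adj W F u w → does (u Fin.≟ v) ≡ does (w Fin.≟ v)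
  respects (e , e∉F , inj₁ eq) =
    trans (off-v e∉F (inj₁ (cong proj₁ eq))) (sym (off-v e∉F (inj₂ (cong proj₂ eq))))
  respects (e , e∉F , inj₂ eq) =
    trans (off-v e∉F (inj₂ (cong proj₂ eq))) (sym (off-v e∉F (inj₁ (cong proj₁ eq))))

W-loopless : ∀ i → proj₁ (ends W i) ≢ proj₂ (ends W i)
W-loopless = toWitness {a? = Fin.all? λ i → ¬? (proj₁ (ends W i) Fin.≟ proj₂ (ends W i))} tt

-- onSide cut s t p decides whether position p of a chain lies on the side of v, where s and t say
-- whether the chain starts and ends at v, and cut ≡ just K means that its (K+1)-th edge is removed.
onSide : Maybe ℕ → Bool → Bool → ℕ → Bool
onSide nothing  _     _     p = false
onSide (just K) true  _     p = does (p ≤? K)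
onSide (just K) false true  p = does (K <? p)
onSide (just K) false false p = false

onSide-step : ∀ cut s t {k} → cut ≢ just k → onSide cut s t k ≡ onSide cut s t (suc k)
onSide-step nothing  _     _     _   = refl
onSide-step (just K) true  _     K≢k =
  does-⇔ (mk⇔ (λ k≤K → ℕ.≤∧≢⇒< k≤K (K≢k ∘ cong just ∘ sym)) ℕ.<⇒≤) (_ ≤? K) (_ ≤? K)
onSide-step (just K) false true  K≢k =
  does-⇔ (mk⇔ ℕ.m<n⇒m<1+n (λ K<1+k → ℕ.≤∧≢⇒< (ℕ.m<1+n⇒m≤n K<1+k) (K≢k ∘ cong just)))
         (K <? _) (K <? _)
onSide-step (just K) false false _   = refl

onSide-start : ∀ cut t → onSide cut false t 0 ≡ false
onSide-start nothing  _     = refl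
onSide-start (just K) true  = refl
onSide-start (just K) false = refl

onSide-end : ∀ cut s {p} → (∀ {K} → cut ≡ just K → K < p) → onSide cut s false p ≡ false
onSide-end nothing  _     _      = refl
onSide-end (just K) true  K<p    = dec-false (_ ≤? K) (ℕ.<⇒≱ (K<p refl))
onSide-end (just K) false _      = refl

module Cuts (x : Fin 12 → ℕ) where
  open Addresses x

  Hits : Vec (Maybe ℕ) 12 → Fin 12 × ℕ → Set
  Hits c (i , k) = lookup c i ≡ just k

  hits? : ∀ c → Decidable (Hits c)
  hits? c (i , k) = Maybe.≡-dec ℕ._≟_ (lookup c i) (just k)

  selected : Vec (Maybe ℕ) 12 → Subset (m (Sub x))
  selected c = tabulate (does ∘ hits? c ∘ address)

  ∈-selected⇔ : ∀ {c e} → e ∈ selected c ⇔ Hits c (address e)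
  ∈-selected⇔ {c} = ∈-tabulate⇔ (hits? c ∘ address)

  -- No edge outside the chosen ones joins the side of v to the rest.
  module _ {F c} (isC : IsChoice F x c) {v} (star⊆F : ∀ e → Incident v e → e ∈ F) where

    startsAt endsAt : Fin 12 → Bool
    startsAt i = does (proj₁ (ends W i) Fin.≟ v)
    endsAt   i = does (proj₂ (ends W i) Fin.≟ v)

    sideAt : Fin 12 → ℕ → Bool
    sideAt i = onSide (lookup c i) (startsAt i) (endsAt i)

    side : SubV x → Bool
    side (inj₁ u)       = does (u Fin.≟ v)
    side (inj₂ (i , j)) = sideAt i (suc (toℕ j))

    sideAt-start : ∀ i → sideAt i 0 ≡ startsAt i
    sideAt-start i with proj₁ (ends W i) Fin.≟ v
    ... | no _ = onSide-start (lookup c i) (endsAt i)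
    ... | yes s≡v with K , cᵢ≡K ← choice-just isC (star⊆F i (inj₁ s≡v)) rewrite cᵢ≡K = refl

    sideAt-end : ∀ i {p} → x i ≤ p → sideAt i p ≡ endsAt i
    sideAt-end i {p} xᵢ≤p with proj₂ (ends W i) Fin.≟ v
    ... | no _ = onSide-end (lookup c i) (startsAt i) λ cᵢ≡K → ℕ.<-≤-trans (choice-< isC cᵢ≡K) xᵢ≤p
    ... | yes t≡v with K , cᵢ≡K ← choice-just isC (star⊆F i (inj₂ t≡v))
      rewrite cᵢ≡K | dec-false (proj₁ (ends W i) Fin.≟ v) (λ s≡v → W-loopless i (trans s≡v (sym t≡v)))
      = dec-true (K <? p) (ℕ.<-≤-trans (choice-< isC cᵢ≡K) xᵢ≤p)

    side-pos : ∀ i p → side (pos x i p) ≡ sideAt i p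
    side-pos i zero = sym (sideAt-start i)
    side-pos i (suc j) with j ℕ.<? (x i ∸ 1)
    ... | yes j<xᵢ-1 = cong (sideAt i ∘ suc) (Fin.toℕ-fromℕ< j<xᵢ-1)
    ... | no  j≮xᵢ-1 = sym (sideAt-end i (ℕ.≤-trans (ℕ.m≤n+m∸n (x i) 1) (ℕ.s≤s (ℕ.≮⇒≥ j≮xᵢ-1))))

    side-edge : ∀ e → e ∉ selected c → side (proj₁ (ends (Sub x) e)) ≡ side (proj₂ (ends (Sub x) e))
    side-edge e e∉ = begin
      side (proj₁ (ends (Sub x) e)) ≡⟨ cong (side ∘ proj₁) (ends≡ e) ⟩
      side (pos x iₑ kₑ)            ≡⟨ side-pos iₑ kₑ ⟩
      sideAt iₑ kₑ                  ≡⟨ onSide-step _ _ _ (e∉ ∘ Equivalence.from (∈-selected⇔ {c = c})) ⟩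
      sideAt iₑ (suc kₑ)            ≡⟨ side-pos iₑ (suc kₑ) ⟨
      side (pos x iₑ (suc kₑ))      ≡⟨ cong (side ∘ proj₂) (ends≡ e) ⟨
      side (proj₂ (ends (Sub x) e)) ∎
      where
      open ≡-Reasoning
      iₑ : Fin 12
      iₑ = proj₁ (address e)
      kₑ : ℕ
      kₑ = proj₂ (address e)

    side-respects : ∀ {u w} → Adj (Sub x) (selected c) u w → side u ≡ side w
    side-respects (e , e∉ , inj₁ eq) =
      subst₂ (λ a b → side a ≡ side b) (cong proj₁ eq) (cong proj₂ eq) (side-edge e e∉)
    side-respects (e , e∉ , inj₂ eq) =
      sym (subst₂ (λ a b → side a ≡ side b) (cong proj₁ eq) (cong proj₂ eq) (side-edge e e∉))

    choice-disconnects : ¬ ConnectedWithout (Sub x) (selected c)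
    choice-disconnects =
      colouring⇒disconnected (Sub x) side side-respects {u = inj₁ v} {w = inj₁ (punchIn v zero)}
        (dec-true (v Fin.≟ v) refl) (dec-false (punchIn v zero Fin.≟ v) (Fin.punchInᵢ≢i v zero))

-- Counting the induced cuts

inducedCutCount : (Fin 12 → ℕ) → ℕ
inducedCutCount x = sum (map (λ F → ∏ F x) vertexSeparating5)

module Counting (x : Fin 12 → ℕ) where
  open Addresses x
  open Cuts x

  InducedCut : Subset (m (Sub x)) → Set
  InducedCut A = IsEdgeCut (Sub x) 5 A × InducedByVS5 x A

  allChoices : List (Vec (Maybe ℕ) 12)
  allChoices = concatMap (λ F → choices F x) vertexSeparating5

  ∈-allChoices⁻ : ∀ {c} → c ∈ₗ allChoices → ∃[ F ] F ∈ₗ vertexSeparating5 × IsChoice F x c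
  ∈-allChoices⁻ c∈ =
    let F , F∈ , c∈′ = ∈-concatMap⁻′ {G = λ F → choices F x} {xs = vertexSeparating5} c∈
    in F , F∈ , ∈-choices⁻ F c∈′

  allChoices-unique : Unique allChoices
  allChoices-unique = unique-concatMap vertexSeparating5-unique (λ F → choices-unique F x)
    λ {F} {F′} c∈ c∈′ → choice-support-unique (∈-choices⁻ F c∈) (∈-choices⁻ F′ c∈′)

  length-allChoices : length allChoices ≡ inducedCutCount x
  length-allChoices = trans (length-concatMap {G = λ F → choices F x} vertexSeparating5)
                            (cong sum (map-cong (λ F → length-choices F x) vertexSeparating5))

  selected-transfers : ∀ {F c c′ i k} → IsChoice F x c → selected c ≡ selected c′ →
                       lookup c i ≡ just k → lookup c′ i ≡ just k
  selected-transfers {c = c} {c′} isC sel≡ cᵢ≡k =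
    let e , e↦ik = address-surjective (choice-< isC cᵢ≡k)
        e∈ = Equivalence.from (∈-selected⇔ {c = c}) (subst (Hits c) (sym e↦ik) cᵢ≡k)
    in subst (Hits c′) e↦ik (Equivalence.to (∈-selected⇔ {c = c′}) (subst (e ∈_) sel≡ e∈))

  selected-injective : ∀ {F F′ c c′} → IsChoice F x c → IsChoice F′ x c′ →
                       selected c ≡ selected c′ → c ≡ c′
  selected-injective {c = c} {c′} isC isC′ sel≡ = begin
    c                    ≡⟨ tabulate∘lookup c ⟨
    tabulate (lookup c)  ≡⟨ tabulate-cong entries-agree ⟩
    tabulate (lookup c′) ≡⟨ tabulate∘lookup c′ ⟩
    c′                   ∎
    where
    open ≡-Reasoning
    entries-agree : ∀ i → lookup c i ≡ lookup c′ i
    entries-agree i = just-agreement (selected-transfers {c′ = c′} {i = i} isC sel≡)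
                                     (selected-transfers {c′ = c} {i = i} isC′ (sym sel≡))

  module Sound {F c} (∣F∣≡5 : ∣ F ∣ ≡ 5) {v} (star⊆F : ∀ e → Incident v e → e ∈ F) (isC : IsChoice F x c)
    where

    f : Fin 5 → Fin 12
    f = proj₁ (enumeration F ∣F∣≡5)

    f-injective : Injective _≡_ _≡_ f
    f-injective = proj₁ (proj₂ (enumeration F ∣F∣≡5))

    f∈F : ∀ j → f j ∈ F
    f∈F = proj₁ (proj₂ (proj₂ (enumeration F ∣F∣≡5)))

    f-covers : Covers {p = F} f
    f-covers = proj₂ (proj₂ (proj₂ (enumeration F ∣F∣≡5)))

    chosen : ∀ j → ∃[ k ] lookup c (f j) ≡ just k
    chosen j = choice-just isC (f∈F j)

    a : Fin 5 → Edge
    a j = proj₁ (address-surjective (choice-< isC (proj₂ (chosen j))))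

    address-a : ∀ j → address (a j) ≡ (f j , proj₁ (chosen j))
    address-a j = proj₂ (address-surjective (choice-< isC (proj₂ (chosen j))))

    chain-a : ∀ j → chain x (a j) ≡ f j
    chain-a j = trans (chain≡ (a j)) (cong proj₁ (address-a j))

    a-injective : Injective _≡_ _≡_ a
    a-injective {j} {j′} aj≡aj′ =
      f-injective (trans (sym (chain-a j)) (trans (cong (chain x) aj≡aj′) (chain-a j′)))

    a∈ : ∀ j → a j ∈ selected c
    a∈ j = Equivalence.from (∈-selected⇔ {c = c}) (subst (Hits c) (sym (address-a j)) (proj₂ (chosen j)))

    a-covers : Covers {p = selected c} a
    a-covers {e} e∈ =
      let hit      = Equivalence.to (∈-selected⇔ {c = c}) e∈
          j , fj≡i = f-covers (choice-∈ isC hit)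
          kⱼ≡k     = just-injective (trans (sym (proj₂ (chosen j))) (trans (cong (lookup c) fj≡i) hit))
      in j , address-injective (trans (address-a j) (cong₂ _,_ fj≡i kⱼ≡k))

    induced : InducedCut (selected c)
    induced = (∣image∣≡ a a-injective a∈ a-covers , choice-disconnects isC star⊆F)
            , F , (∣F∣≡5 , vertexSeparating⇒disconnected (v , star⊆F)) , (v , star⊆F)
            , a , f , (λ e → mk⇔ a-covers λ { (j , refl) → a∈ j })
            , (λ i → mk⇔ f-covers λ { (j , refl) → f∈F j })
            , chain-a

  module Complete {A F} (∣F∣≡5 : ∣ F ∣ ≡ 5) (a : Fin 5 → Edge) (f : Fin 5 → Fin 12)
                  (A⇔ : ∀ e → e ∈ A ⇔ (∃[ j ] a j ≡ e)) (F⇔ : ∀ i → i ∈ F ⇔ (∃[ j ] f j ≡ i))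
                  (chain-a : ∀ j → chain x (a j) ≡ f j) where

    f-covers : Covers {p = F} f
    f-covers {i} = Equivalence.to (F⇔ i)

    f-injective : Injective _≡_ _≡_ f
    f-injective = covering-injective f ∣F∣≡5 f-covers

    address₁-a : ∀ j → proj₁ (address (a j)) ≡ f j
    address₁-a j = trans (sym (chain≡ (a j))) (chain-a j)

    entry : ∀ i → Dec (i ∈ F) → Maybe ℕ
    entry i (yes i∈F) = just (proj₂ (address (a (proj₁ (f-covers i∈F)))))
    entry i (no  _)   = nothing

    entry-∈ : ∀ {i} (i∈F? : Dec (i ∈ F)) → i ∈ F →
              ∃[ j ] f j ≡ i × entry i i∈F? ≡ just (proj₂ (address (a j)))
    entry-∈ (yes i∈F) _   = proj₁ (f-covers i∈F) , proj₂ (f-covers i∈F) , refl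
    entry-∈ (no  i∉F) i∈F = contradiction i∈F i∉F

    entry-∉ : ∀ {i} (i∈F? : Dec (i ∈ F)) → i ∉ F → entry i i∈F? ≡ nothing
    entry-∉ (yes i∈F) i∉F = contradiction i∈F i∉F
    entry-∉ (no  _)   _   = refl

    cᴬ : Vec (Maybe ℕ) 12
    cᴬ = tabulate λ i → entry i (i ∈? F)

    lookup-cᴬ : ∀ i → lookup cᴬ i ≡ entry i (i ∈? F)
    lookup-cᴬ = lookup∘tabulate _

    isCᴬ : IsChoice F x cᴬ
    isCᴬ = pointwise⇒choice F cᴬ chosen (λ {i} i∉F → trans (lookup-cᴬ i) (entry-∉ (i ∈? F) i∉F))
      where
      chosen : ∀ {i} → i ∈ F → ∃[ k ] lookup cᴬ i ≡ just k × k < x i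
      chosen {i} i∈F =
        let j , fj≡i , entry≡ = entry-∈ (i ∈? F) i∈F
        in _ , trans (lookup-cᴬ i) entry≡
             , subst (λ t → proj₂ (address (a j)) < x t) (trans (address₁-a j) fj≡i) (address-< (a j))

    hits-a : ∀ j → Hits cᴬ (address (a j))
    hits-a j =
      let j′ , fj′≡fj , entry≡ = entry-∈ (f j ∈? F) (Equivalence.from (F⇔ (f j)) (j , refl))
          j′≡j = f-injective fj′≡fj
      in begin
        lookup cᴬ (proj₁ (address (a j))) ≡⟨ cong (lookup cᴬ) (address₁-a j) ⟩
        lookup cᴬ (f j)                   ≡⟨ lookup-cᴬ (f j) ⟩
        entry (f j) (f j ∈? F)            ≡⟨ entry≡ ⟩
        just (proj₂ (address (a j′)))     ≡⟨ cong (λ t → just (proj₂ (address (a t)))) j′≡j ⟩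
        just (proj₂ (address (a j)))      ∎
      where open ≡-Reasoning

    hits⇒∈A : ∀ {e} → Hits cᴬ (address e) → e ∈ A
    hits⇒∈A {e} hit =
      let i∈F = choice-∈ isCᴬ hit
          j , fj≡i , entry≡ = entry-∈ (_ ∈? F) i∈F
          kⱼ≡k = just-injective (trans (sym entry≡) (trans (sym (lookup-cᴬ _)) hit))
      in Equivalence.from (A⇔ e) (j , address-injective (cong₂ _,_ (trans (address₁-a j) fj≡i) kⱼ≡k))

    selected≡A : selected cᴬ ≡ A
    selected≡A = ⊆-antisym (hits⇒∈A ∘ Equivalence.to (∈-selected⇔ {c = cᴬ})) A⊆selected
      where
      A⊆selected : ∀ {e} → e ∈ A → e ∈ selected cᴬ
      A⊆selected {e} e∈A = let j , aj≡e = Equivalence.to (A⇔ e) e∈A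
                           in subst (_∈ selected cᴬ) aj≡e (Equivalence.from (∈-selected⇔ {c = cᴬ}) (hits-a j))

  inducedCuts : List (Subset (m (Sub x)))
  inducedCuts = map selected allChoices

  inducedCuts-sound : ∀ {A} → A ∈ₗ inducedCuts → InducedCut A
  inducedCuts-sound A∈ =
    let c , c∈ , A≡ = ∈-map⁻ selected A∈
        F , F∈ , isC = ∈-allChoices⁻ c∈
        ∣F∣≡5 , (v , star⊆F) = Equivalence.to ∈-vertexSeparating5⇔ F∈
    in subst InducedCut (sym A≡) (Sound.induced ∣F∣≡5 star⊆F isC)

  inducedCuts-complete : ∀ {A} → InducedCut A → A ∈ₗ inducedCuts
  inducedCuts-complete (_ , F , (∣F∣≡5 , _) , vs , a , f , A⇔ , F⇔ , chain-a) =
    subst (_∈ₗ inducedCuts) C.selected≡A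
      (∈-map⁺ selected (∈-concatMap⁺′ (Equivalence.from ∈-vertexSeparating5⇔ (∣F∣≡5 , vs))
                                      (∈-choices⁺ C.isCᴬ)))
    where module C = Complete ∣F∣≡5 a f A⇔ F⇔ chain-a

  inducedCuts-unique : Unique inducedCuts
  inducedCuts-unique = unique-map-on allChoices-unique λ c∈ c′∈ →
    selected-injective (proj₂ (proj₂ (∈-allChoices⁻ c∈))) (proj₂ (proj₂ (∈-allChoices⁻ c′∈)))

  μ₅ⱽ-subdivision : Mu5V≡ x (inducedCutCount x)
  μ₅ⱽ-subdivision = inducedCuts , inducedCuts-unique , (λ A → mk⇔ inducedCuts-sound inducedCuts-complete)
                  , trans (length-map selected allChoices) length-allChoices

-- The difference as a polynomial identity

monomial : Subset n → (Fin n → Polynomial k) → Polynomial k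
monomial []            t = con (+ 1)
monomial (outside ∷ F) t = monomial F (t ∘ suc)
monomial (inside  ∷ F) t = t zero :* monomial F (t ∘ suc)

polynomialOf : List (Subset n) → (Fin n → Polynomial k) → Polynomial k
polynomialOf []       t = con (+ 0)
polynomialOf (F ∷ Fs) t = monomial F t :+ polynomialOf Fs t

module _ {ρ : Vec ℤ k} where

  ⟦monomial⟧ : ∀ {x : Fin n → ℕ} {t} → (∀ i → + x i ≡ ⟦ t i ⟧ ρ) → (F : Subset n) →
               + ∏ F x ≡ ⟦ monomial F t ⟧ ρ
  ⟦monomial⟧           x≡t []            = refl
  ⟦monomial⟧           x≡t (outside ∷ F) = ⟦monomial⟧ (x≡t ∘ suc) F
  ⟦monomial⟧ {x = x}   x≡t (inside  ∷ F) =
    trans (ℤ.pos-* (x zero) (∏ F (x ∘ suc))) (cong₂ ℤ._*_ (x≡t zero) (⟦monomial⟧ (x≡t ∘ suc) F))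

  ⟦polynomialOf⟧ : ∀ {x : Fin n → ℕ} {t} → (∀ i → + x i ≡ ⟦ t i ⟧ ρ) → (Fs : List (Subset n)) →
                   + sum (map (λ F → ∏ F x) Fs) ≡ ⟦ polynomialOf Fs t ⟧ ρ
  ⟦polynomialOf⟧         x≡t []       = refl
  ⟦polynomialOf⟧ {x = x} x≡t (F ∷ Fs) =
    trans (ℤ.pos-+ (∏ F x) (sum (map (λ F → ∏ F x) Fs)))
          (cong₂ ℤ._+_ (⟦monomial⟧ x≡t F) (⟦polynomialOf⟧ x≡t Fs))

-- ℓ′_i as a polynomial in the ℓ's, variable i standing for ℓ_{i+1}.
shifted : Fin 12 → Polynomial 12
shifted zero                           = var zero :+ con (+ 1)
shifted i@(suc (suc (suc (suc zero)))) = var i :- con (+ 1)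
shifted i                              = var i

Σ₁ᴾ : List ℕ → (ℕ → Polynomial 12) → Polynomial 12
Σ₁ᴾ []       f = con (+ 0)
Σ₁ᴾ (i ∷ is) f = f i :+ Σ₁ᴾ is f

Σ₂ᴾ : List ℕ → (ℕ → Polynomial 12) → Polynomial 12
Σ₂ᴾ []       f = con (+ 0)
Σ₂ᴾ (i ∷ is) f = Σ₁ᴾ is (λ j → f i :* f j) :+ Σ₂ᴾ is f

-- RHS with ℓ_i replaced by variable i - 1; only indices 1 … 12 occur.
rhsPolynomial : Polynomial 12
rhsPolynomial =
    L 3 :* L 6 :* L 9 :* L 10 :+ L 4 :* L 7 :* L 9 :* L 10 :- L 2 :* L 3 :* L 7 :* L 12 :- L 3 :* L 6 :* L 9 :* L 12
  :+ d :* (L 2 :* L 7 :* L 12 :+ L 4 :* L 7 :* L 10 :+ L 3 :* L 6 :* L 9 :+ L 2 :* L 6 :* L 11 :+ L 4 :* L 8 :* L 11)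
  :- d :* (L 8 :* L 9 :* L 10 :+ L 3 :* L 8 :* L 12 :+ L 4 :* L 8 :* L 11)
  :+ L 3 :* L 12 :* (Σ₂ᴾ (minus (1 ∷ 3 ∷ 5 ∷ 12 ∷ [])) L :+ d :* Σ₁ᴾ (minus (1 ∷ 3 ∷ 5 ∷ 12 ∷ [])) L)
  :+ L 9 :* L 10 :* (d :* Σ₁ᴾ (minus (1 ∷ 5 ∷ 9 ∷ 10 ∷ [])) L :- Σ₂ᴾ (minus (1 ∷ 5 ∷ 9 ∷ 10 ∷ [])) L)
  :+ L 8 :* d :* Σ₂ᴾ (minus (1 ∷ 5 ∷ 8 ∷ [])) L
  where
  L : ℕ → Polynomial 12
  L i = var ((i ∸ 1) mod 12)
  d : Polynomial 12
  d = L 1 :+ con (+ 1) :- L 5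

differencePolynomial : Polynomial 12
differencePolynomial = polynomialOf vertexSeparating5 var :- polynomialOf vertexSeparating5 shifted

opaque
  unfolding vertexSeparating5 subsetsOfSize

  difference-identity : ∀ ρ → ⟦ differencePolynomial ⟧ ρ ≡ ⟦ rhsPolynomial ⟧ ρ
  difference-identity ρ = prove ρ differencePolynomial rhsPolynomial refl

sOf-positive : 8 ≤ n → 1 ≤ sOf n
sOf-positive 8≤n = m≥n⇒m/n>0 (ℕ.+-monoˡ-≤ 4 8≤n)

ℓ-positive : 8 ≤ n → ∀ i → 1 ≤ ℓ n i
ℓ-positive {n = n} 8≤n i with inX (rOf n) i
... | true  = s≤s z≤n
... | false = sOf-positive 8≤n

module Lengths (n : ℕ) where

  ρ : Vec ℤ 12
  ρ = tabulate (λ i → + Gn n i)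

  G-lengths : ∀ i → + Gn n i ≡ ⟦ var i ⟧ ρ
  G-lengths i = sym (lookup∘tabulate (λ i → + Gn n i) i)

  -- ℓ′₅ = ℓ₅ ∸ 1 is a truncated subtraction, hence the hypothesis.
  H-lengths : 8 ≤ n → ∀ i → + Hn n i ≡ ⟦ shifted i ⟧ ρ
  H-lengths _ zero = cong +_ (ℕ.+-comm 1 (ℓ n 1))
  H-lengths _ (suc zero) = refl
  H-lengths _ (suc (suc zero)) = refl
  H-lengths _ (suc (suc (suc zero))) = refl
  H-lengths 8≤n (suc (suc (suc (suc zero)))) =
    sym (trans (ℤ.[+m]-[+n]≡m⊖n (ℓ n 5) 1) (ℤ.⊖-≥ (ℓ-positive 8≤n 5)))
  H-lengths _ (suc (suc (suc (suc (suc zero))))) = refl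
  H-lengths _ (suc (suc (suc (suc (suc (suc zero)))))) = refl
  H-lengths _ (suc (suc (suc (suc (suc (suc (suc zero))))))) = refl
  H-lengths _ (suc (suc (suc (suc (suc (suc (suc (suc zero)))))))) = refl
  H-lengths _ (suc (suc (suc (suc (suc (suc (suc (suc (suc zero))))))))) = refl
  H-lengths _ (suc (suc (suc (suc (suc (suc (suc (suc (suc (suc zero)))))))))) = refl
  H-lengths _ (suc (suc (suc (suc (suc (suc (suc (suc (suc (suc (suc zero))))))))))) = refl

  ⟦rhsPolynomial⟧ : ⟦ rhsPolynomial ⟧ ρ ≡ RHS n
  ⟦rhsPolynomial⟧ = refl

inducedCutCount-difference : ∀ n → 8 ≤ n → + inducedCutCount (Gn n) - + inducedCutCount (Hn n) ≡ RHS n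
inducedCutCount-difference n 8≤n = begin
  + inducedCutCount (Gn n) - + inducedCutCount (Hn n)
    ≡⟨ cong₂ _-_ (⟦polynomialOf⟧ G-lengths vertexSeparating5)
                 (⟦polynomialOf⟧ (H-lengths 8≤n) vertexSeparating5) ⟩
  ⟦ differencePolynomial ⟧ ρ
    ≡⟨ difference-identity ρ ⟩
  ⟦ rhsPolynomial ⟧ ρ
    ≡⟨ ⟦rhsPolynomial⟧ ⟩
  RHS n ∎
  where
  open Lengths n
  open ≡-Reasoning

lemma12 : (n : ℕ) → 13 ≤ n → n ≢ 16 →
    Σ ℕ λ a → Σ ℕ λ b →
      Mu5V≡ (Gn n) a × Mu5V≡ (Hn n) b × ((+ a) - (+ b) ≡ RHS n)
lemma12 n 13≤n _ = _ , _ , Counting.μ₅ⱽ-subdivision (Gn n) , Counting.μ₅ⱽ-subdivision (Hn n)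
                 , inducedCutCount-difference n (ℕ.≤-trans (ℕ.m≤m+n 8 5) 13≤n)
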